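{- There is an absolute constant $C>0$ such that for all integers $n\ge k\ge 2$ there exists an $n$-vertex tournament $T$ with $\Delta^+(T)-\delta^+(T)\le C\,\frac{n}{k}$ such that $T$ does not contain a $1$-subdivision of $\vec{K}_k$.
   Context: A tournament is a digraph in which for every two distinct vertices $u,v$ exactly one of the arcs $\vec{uv}$, $\vec{vu}$ is present. $\Delta^+(T)$ and $\delta^+(T)$ are the maximum and minimum out-degree of $T$. $\vec{K}_k$ is the complete digraph on $k$ vertices containing all $k(k-1)$ arcs. A $1$-subdivision of a digraph $D$ is obtained by replacing every arc $\vec{uv}$ of $D$ by a directed path of length $2$ from $u$ to $v$ through a new vertex (distinct new vertices for distinct arcs). -}

module Defs where

open import Data.Nat using (ℕ; _+_; _⊔_; _⊓_)
open import Data.Bool using (Bool; true; false; if_then_else_)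
open import Data.Fin using (Fin)
open import Data.List using (List; foldr; map; allFin)
open import Data.Nat.ListAction using (sum)
open import Data.Sum using (_⊎_)
open import Data.Product using (Σ; _×_; _,_)
open import Relation.Binary.PropositionalEquality using (_≡_; _≢_)
open import Relation.Nullary using (¬_)
open import Function.Definitions using (Injective)

Digraph : ℕ → Set
Digraph n = Fin n → Fin n → Bool

IsTournament : {n : ℕ} → Digraph n → Set
IsTournament {n} T =
  ((u : Fin n) → T u u ≡ false) ×
  ((u v : Fin n) → u ≢ v → ((T u v ≡ true × T v u ≡ false) ⊎ (T u v ≡ false × T v u ≡ true)))

outDeg : {n : ℕ} → Digraph n → Fin n → ℕ
outDeg {n} T u = sum (map (λ v → if T u v then 1 else 0) (allFin n))

-- maximum out-degree Δ⁺ (0 for the empty digraph)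
maxOutDeg : {n : ℕ} → Digraph n → ℕ
maxOutDeg {n} T = foldr _⊔_ 0 (map (outDeg T) (allFin n))

-- minimum out-degree δ⁺ (seeded with n, which exceeds every out-degree,
-- so for n ≥ 1 this is the true minimum)
minOutDeg : {n : ℕ} → Digraph n → ℕ
minOutDeg {n} T = foldr _⊓_ n (map (outDeg T) (allFin n))

ContainsSubdivK : {n : ℕ} → Digraph n → ℕ → Set
ContainsSubdivK {n} D k =
  Σ (Fin k → Fin n) λ f →
  Σ ((a b : Fin k) → a ≢ b → Fin n) λ s →
    Injective _≡_ _≡_ f ×
    ((a b : Fin k) (p : a ≢ b) (a' b' : Fin k) (p' : a' ≢ b') →
       s a b p ≡ s a' b' p' → (a ≡ a' × b ≡ b')) ×
    ((a b : Fin k) (p : a ≢ b) (c : Fin k) → s a b p ≢ f c) ×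
    ((a b : Fin k) (p : a ≢ b) → (D (f a) (s a b p) ≡ true × D (s a b p) (f b) ≡ true))

module Submission where

-- Split the vertices 0, …, n−1 into the m = k − 1 residue classes mod m, orient each class by
-- the natural order, and orient arcs between classes by the tournament on ℕ in which b → c iff
-- b + c is odd for b < c and even for b > c.  Two of the k branch vertices of a 1-subdivision of
-- K⃗_k share a class, say x < z, and the path z → w → x through a subdivision vertex is
-- impossible: inside a class arcs go upwards, and between two classes they go one way only.
-- The parity tournament is balanced on every prefix: any b has r/2 out-neighbours among the
-- classes c < r, up to an error of 2.  As the larger classes (of size ⌊n/m⌋ + 1) form a prefix,
-- every out-degree is (n/m)·(out-degree into one period) + (out-degree into a prefix), up to the
-- n/m + 1 vertices of the own class, so all out-degrees lie within 3(n/m + 1) ≤ 9n/k.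

open import Defs

open import Data.Bool using (Bool; true; false; not; _xor_; if_then_else_)
open import Data.Bool.Properties using (not-involutive)
open import Data.Empty using (⊥)
open import Data.Fin using (Fin; toℕ)
open import Data.Fin.Properties using (toℕ-injective; toℕ-fromℕ<; pigeonhole) renaming (<⇒≢ to <⇒≢ᶠ)
open import Data.List using (map; allFin; tabulate)
open import Data.List.Properties using (map-tabulate; foldr-preservesᵇ)
open import Data.List.Relation.Unary.All using (All)
import Data.List.Relation.Unary.All.Properties as All
open import Data.Nat using (ℕ; zero; suc; _+_; _*_; _∸_; _%_; _/_; _≤_; _<_; _≟_; _<?_; _≤?_; z≤n; s≤s; z<s; s<s; NonZero)
open import Data.Nat.DivMod using (_mod_; m≡m%n+[m/n]*n; [m+n]%n≡m%n; [m+kn]%n≡m%n; m<n⇒m%n≡m; m%n<n; m/n*n≤m)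
open import Data.Nat.ListAction using (sum)
open import Data.Nat.Properties
open import Data.Nat.Tactic.RingSolver using (solve-∀)
open import Data.Product using (Σ; _×_; _,_)
open import Data.Sum using (_⊎_; inj₁; inj₂)
open import Function using (_∘_; id)
open import Relation.Binary using (tri<; tri≈; tri>)
open import Relation.Binary.PropositionalEquality
open import Relation.Nullary using (does; ¬_; contradiction; yes; no)
open import Relation.Nullary.Decidable using (dec-true; dec-false)

open import Algebra.Properties.CommutativeSemigroup +-commutativeSemigroup using (interchange)

sumBelow : ℕ → (ℕ → ℕ) → ℕ
sumBelow zero    g = 0
sumBelow (suc n) g = g 0 + sumBelow n (g ∘ suc)

sumBelow-cong : ∀ n {g h : ℕ → ℕ} → (∀ {y} → y < n → g y ≡ h y) → sumBelow n g ≡ sumBelow n h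
sumBelow-cong zero    eq = refl
sumBelow-cong (suc n) eq = cong₂ _+_ (eq z<s) (sumBelow-cong n (eq ∘ s<s))

sumBelow-mono-≤ : ∀ n {g h : ℕ → ℕ} → (∀ y → g y ≤ h y) → sumBelow n g ≤ sumBelow n h
sumBelow-mono-≤ zero    le = z≤n
sumBelow-mono-≤ (suc n) le = +-mono-≤ (le 0) (sumBelow-mono-≤ n (le ∘ suc))

sumBelow-+ : ∀ n (g h : ℕ → ℕ) → sumBelow n (λ y → g y + h y) ≡ sumBelow n g + sumBelow n h
sumBelow-+ zero    g h = refl
sumBelow-+ (suc n) g h = trans (cong (g 0 + h 0 +_) (sumBelow-+ n (g ∘ suc) (h ∘ suc)))
                               (interchange (g 0) (h 0) _ _)

sumBelow-split : ∀ a b (g : ℕ → ℕ) → sumBelow (a + b) g ≡ sumBelow a g + sumBelow b (g ∘ (a +_))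
sumBelow-split zero    b g = refl
sumBelow-split (suc a) b g =
  trans (cong (g 0 +_) (sumBelow-split a b (g ∘ suc))) (sym (+-assoc (g 0) _ _))

sumBelow-suc : ∀ n (g : ℕ → ℕ) → sumBelow (suc n) g ≡ sumBelow n g + g n
sumBelow-suc zero    g = +-comm (g 0) 0
sumBelow-suc (suc n) g = trans (cong (g 0 +_) (sumBelow-suc n (g ∘ suc))) (sym (+-assoc (g 0) _ _))

sumBelow-const : ∀ n c → sumBelow n (λ _ → c) ≡ n * c
sumBelow-const zero    c = refl
sumBelow-const (suc n) c = cong (c +_) (sumBelow-const n c)

sumBelow-periodic : ∀ m .{{_ : NonZero m}} n (h : ℕ → ℕ) →
  sumBelow n (h ∘ (_% m)) ≡ (n / m) * sumBelow m h + sumBelow (n % m) h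
sumBelow-periodic m n h = begin
  sumBelow n (h ∘ (_% m))
    ≡⟨ cong (λ k → sumBelow k (h ∘ (_% m))) n≡qm+r ⟩
  sumBelow (q * m + r) (h ∘ (_% m))
    ≡⟨ sumBelow-split (q * m) r (h ∘ (_% m)) ⟩
  sumBelow (q * m) (h ∘ (_% m)) + sumBelow r (λ y → h ((q * m + y) % m))
    ≡⟨ cong₂ _+_ (blocks q) (sumBelow-cong r λ y<r → cong h (tail y<r)) ⟩
  q * sumBelow m h + sumBelow r h ∎
  where
  open ≡-Reasoning
  q = n / m
  r = n % m
  n≡qm+r : n ≡ q * m + r
  n≡qm+r = trans (m≡m%n+[m/n]*n n m) (+-comm r (q * m))
  blocks : ∀ p → sumBelow (p * m) (h ∘ (_% m)) ≡ p * sumBelow m h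
  blocks zero    = refl
  blocks (suc p) = trans (sumBelow-split m (p * m) (h ∘ (_% m)))
    (cong₂ _+_ (sumBelow-cong m (cong h ∘ m<n⇒m%n≡m))
               (trans (sumBelow-cong (p * m) λ {y} _ →
                        cong h (trans (cong (_% m) (+-comm m y)) ([m+n]%n≡m%n y m)))
                      (blocks p)))
  tail : ∀ {y} → y < r → (q * m + y) % m ≡ y
  tail {y} y<r = trans (cong (_% m) (+-comm (q * m) y))
    (trans ([m+kn]%n≡m%n y q m) (m<n⇒m%n≡m (<-trans y<r (m%n<n n m))))

indicator : Bool → ℕ
indicator b = if b then 1 else 0

indicator≤1 : ∀ b → indicator b ≤ 1
indicator≤1 true  = ≤-refl
indicator≤1 false = z≤n

indicator-not : ∀ b → indicator b + indicator (not b) ≡ 1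
indicator-not true  = refl
indicator-not false = refl

sumBelow-indicator-≟ : ∀ b k → sumBelow k (λ d → indicator (does (b ≟ d))) ≤ 1
sumBelow-indicator-≟ b       zero    = z≤n
sumBelow-indicator-≟ zero    (suc k) = s≤s (≤-reflexive (trans (sumBelow-const k 0) (*-zeroʳ k)))
sumBelow-indicator-≟ (suc b) (suc k) = sumBelow-indicator-≟ b k

odd : ℕ → Bool
odd zero    = false
odd (suc n) = not (odd n)

odd-+-suc : ∀ a b → odd (a + suc b) ≡ not (odd (a + b))
odd-+-suc a b = cong odd (+-suc a b)

odd-double : ∀ a → odd (a + a) ≡ false
odd-double zero    = refl
odd-double (suc a) = begin
  not (odd (a + suc a)) ≡⟨ cong not (odd-+-suc a a) ⟩
  not (not (odd (a + a))) ≡⟨ not-involutive _ ⟩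
  odd (a + a) ≡⟨ odd-double a ⟩
  false ∎
  where open ≡-Reasoning

-- The loop parityArc b b = true is deliberate: it makes every pair {r, r + 1} of consecutive
-- targets contain an out-neighbour, the pair {b, b + 1} even two.
parityArc : ℕ → ℕ → Bool
parityArc b c = does (c ≤? b) xor odd (b + c)

parityArc-below : ∀ b {c} → c ≤ b → parityArc b c ≡ not (odd (b + c))
parityArc-below b {c} c≤b rewrite dec-true (c ≤? b) c≤b = refl

parityArc-above : ∀ b {c} → b < c → parityArc b c ≡ odd (b + c)
parityArc-above b {c} b<c rewrite dec-false (c ≤? b) (<⇒≱ b<c) = refl

parityArc-refl : ∀ b → parityArc b b ≡ true
parityArc-refl b = trans (parityArc-below b ≤-refl) (cong not (odd-double b))

parityArc-flip : ∀ {b c} → b ≢ c → parityArc c b ≡ not (parityArc b c)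
parityArc-flip {b} {c} b≢c with <-cmp b c
... | tri< b<c _ _ = begin
  parityArc c b         ≡⟨ parityArc-below _ (<⇒≤ b<c) ⟩
  not (odd (c + b))     ≡⟨ cong (not ∘ odd) (+-comm c b) ⟩
  not (odd (b + c))     ≡⟨ cong not (parityArc-above b b<c) ⟨
  not (parityArc b c)   ∎
  where open ≡-Reasoning
... | tri≈ _ b≡c _ = contradiction b≡c b≢c
... | tri> _ _ c<b = begin
  parityArc c b             ≡⟨ parityArc-above c c<b ⟩
  odd (c + b)               ≡⟨ cong odd (+-comm c b) ⟩
  odd (b + c)               ≡⟨ not-involutive _ ⟨
  not (not (odd (b + c)))   ≡⟨ cong not (parityArc-below _ (<⇒≤ c<b)) ⟨
  not (parityArc b c)       ∎
  where open ≡-Reasoning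

outPrefix : ℕ → ℕ → ℕ
outPrefix b r = sumBelow r (indicator ∘ parityArc b)

pairCount : ℕ → ℕ → ℕ
pairCount b r = indicator (parityArc b r) + indicator (parityArc b (suc r))

pairCount-≢ : ∀ {b r} → r ≢ b → pairCount b r ≡ 1
pairCount-≢ {b} {r} r≢b with <-cmp r b
... | tri< r<b _ _ = begin
  pairCount b r
    ≡⟨ cong₂ (λ x y → indicator x + indicator y) (parityArc-below _ (<⇒≤ r<b)) (parityArc-below b r<b) ⟩
  indicator (not (odd (b + r))) + indicator (not (odd (b + suc r)))
    ≡⟨ cong (λ x → indicator (not (odd (b + r))) + indicator (not x)) (odd-+-suc b r) ⟩
  indicator (not (odd (b + r))) + indicator (not (not (odd (b + r))))
    ≡⟨ indicator-not (not (odd (b + r))) ⟩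
  1 ∎
  where open ≡-Reasoning
... | tri≈ _ r≡b _ = contradiction r≡b r≢b
... | tri> _ _ b<r = begin
  pairCount b r
    ≡⟨ cong₂ (λ x y → indicator x + indicator y) (parityArc-above b b<r) (parityArc-above _ (m<n⇒m<1+n b<r)) ⟩
  indicator (odd (b + r)) + indicator (odd (b + suc r))
    ≡⟨ cong (λ x → indicator (odd (b + r)) + indicator x) (odd-+-suc b r) ⟩
  indicator (odd (b + r)) + indicator (not (odd (b + r)))
    ≡⟨ indicator-not (odd (b + r)) ⟩
  1 ∎
  where open ≡-Reasoning

pairCount-self : ∀ b → pairCount b b ≡ 2
pairCount-self b = cong₂ (λ x y → indicator x + indicator y) (parityArc-refl b) (begin
  parityArc b (suc b)       ≡⟨ parityArc-above _ (n<1+n b) ⟩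
  odd (b + suc b)           ≡⟨ odd-+-suc b b ⟩
  not (odd (b + b))         ≡⟨ cong not (odd-double b) ⟩
  true                      ∎)
  where open ≡-Reasoning

outPrefix-step : ∀ b r → outPrefix b (2 + r) ≡ pairCount b r + outPrefix b r
outPrefix-step b r = begin
  outPrefix b (2 + r)           ≡⟨ sumBelow-suc (suc r) g ⟩
  outPrefix b (suc r) + g (suc r) ≡⟨ cong (_+ g (suc r)) (sumBelow-suc r g) ⟩
  outPrefix b r + g r + g (suc r) ≡⟨ +-assoc (outPrefix b r) _ _ ⟩
  outPrefix b r + pairCount b r ≡⟨ +-comm (outPrefix b r) _ ⟩
  pairCount b r + outPrefix b r ∎
  where
  open ≡-Reasoning
  g = indicator ∘ parityArc b

1≤pairCount : ∀ b r → 1 ≤ pairCount b r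
1≤pairCount b r with r ≟ b
... | yes refl = ≤-trans (s≤s z≤n) (≤-reflexive (sym (pairCount-self b)))
... | no r≢b   = ≤-reflexive (sym (pairCount-≢ r≢b))

outPrefix-1≤1 : ∀ b → outPrefix b 1 ≤ 1
outPrefix-1≤1 b = ≤-trans (≤-reflexive (+-identityʳ _)) (indicator≤1 (parityArc b 0))

outPrefix-lower : ∀ b r → r ≤ 1 + 2 * outPrefix b r
outPrefix-lower b 0 = z≤n
outPrefix-lower b 1 = s≤s z≤n
outPrefix-lower b (suc (suc r)) = begin
  2 + r                         ≤⟨ +-monoʳ-≤ 2 (outPrefix-lower b r) ⟩
  1 + (2 + 2 * A)               ≡⟨ cong suc (*-suc 2 A) ⟨
  1 + 2 * (1 + A)               ≤⟨ +-monoʳ-≤ 1 (*-monoʳ-≤ 2 (+-monoˡ-≤ A (1≤pairCount b r))) ⟩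
  1 + 2 * (pairCount b r + A)   ≡⟨ cong (λ z → 1 + 2 * z) (outPrefix-step b r) ⟨
  1 + 2 * outPrefix b (2 + r)   ∎
  where
  open ≤-Reasoning
  A = outPrefix b r

outPrefix-upper-≤ : ∀ b r → r ≤ b → 2 * outPrefix b r ≤ 1 + r
outPrefix-upper-≤ b 0 _ = z≤n
outPrefix-upper-≤ b 1 _ = *-monoʳ-≤ 2 (outPrefix-1≤1 b)
outPrefix-upper-≤ b (suc (suc r)) r+2≤b = begin
  2 * outPrefix b (2 + r)       ≡⟨ cong (2 *_) (outPrefix-step b r) ⟩
  2 * (pairCount b r + A)       ≡⟨ cong (λ p → 2 * (p + A)) (pairCount-≢ (<⇒≢ r<b)) ⟩
  2 * (1 + A)                   ≡⟨ *-suc 2 A ⟩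
  2 + 2 * A                     ≤⟨ +-monoʳ-≤ 2 (outPrefix-upper-≤ b r (<⇒≤ r<b)) ⟩
  2 + (1 + r)                   ∎
  where
  open ≤-Reasoning
  A = outPrefix b r
  r<b : r < b
  r<b = <-trans (n<1+n r) r+2≤b

outPrefix-upper : ∀ b r → 2 * outPrefix b r ≤ 3 + r
outPrefix-upper b 0 = z≤n
outPrefix-upper b 1 = ≤-trans (*-monoʳ-≤ 2 (outPrefix-1≤1 b)) (m≤n+m 2 2)
outPrefix-upper b (suc (suc r)) with r ≟ b
... | yes refl = begin
  2 * outPrefix b (2 + b)       ≡⟨ cong (2 *_) (outPrefix-step b b) ⟩
  2 * (pairCount b b + A)       ≡⟨ cong (λ p → 2 * (p + A)) (pairCount-self b) ⟩
  2 * (2 + A)                   ≡⟨ *-distribˡ-+ 2 2 A ⟩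
  4 + 2 * A                     ≤⟨ +-monoʳ-≤ 4 (outPrefix-upper-≤ b b ≤-refl) ⟩
  3 + (2 + b)                   ∎
  where
  open ≤-Reasoning
  A = outPrefix b b
... | no r≢b = begin
  2 * outPrefix b (2 + r)       ≡⟨ cong (2 *_) (outPrefix-step b r) ⟩
  2 * (pairCount b r + A)       ≡⟨ cong (λ p → 2 * (p + A)) (pairCount-≢ r≢b) ⟩
  2 * (1 + A)                   ≡⟨ *-suc 2 A ⟩
  2 + 2 * A                     ≤⟨ +-monoʳ-≤ 2 (outPrefix-upper b r) ⟩
  3 + (2 + r)                   ∎
  where
  open ≤-Reasoning
  A = outPrefix b r

outPrefix-close : ∀ b b' r → outPrefix b r ≤ 2 + outPrefix b' r
outPrefix-close b b' r = *-cancelˡ-≤ 2 (begin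
  2 * outPrefix b r             ≤⟨ outPrefix-upper b r ⟩
  3 + r                         ≤⟨ +-monoʳ-≤ 3 (outPrefix-lower b' r) ⟩
  4 + 2 * outPrefix b' r        ≡⟨ *-distribˡ-+ 2 2 (outPrefix b' r) ⟨
  2 * (2 + outPrefix b' r)      ∎)
  where open ≤-Reasoning

does-<?-flip : ∀ {x y} → x ≢ y → does (y <? x) ≡ not (does (x <? y))
does-<?-flip {x} {y} x≢y with <-cmp x y
... | tri< x<y _ _ = trans (dec-false (y <? x) (<⇒≯ x<y)) (cong not (sym (dec-true (x <? y) x<y)))
... | tri≈ _ x≡y _ = contradiction x≡y x≢y
... | tri> _ _ y<x = trans (dec-true (y <? x) y<x) (cong not (sym (dec-false (x <? y) (<⇒≯ y<x))))

sum-map-allFin : ∀ n (g : ℕ → ℕ) → sum (map (g ∘ toℕ) (allFin n)) ≡ sumBelow n g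
sum-map-allFin n g = trans (cong sum (map-tabulate {n = n} id (g ∘ toℕ))) (sum-tabulate n g)
  where
  sum-tabulate : ∀ n (g : ℕ → ℕ) → sum (tabulate {n = n} (g ∘ toℕ)) ≡ sumBelow n g
  sum-tabulate zero    g = refl
  sum-tabulate (suc n) g = cong (g 0 +_) (sum-tabulate n (g ∘ suc))

isTournament-fromFlip : ∀ {n} {T : Digraph n} → (∀ u → T u u ≡ false) →
  (∀ u v → u ≢ v → T v u ≡ not (T u v)) → IsTournament T
isTournament-fromFlip irrefl flip = irrefl , λ u v u≢v → exactlyOne (flip u v u≢v)
  where
  exactlyOne : ∀ {a b} → b ≡ not a → (a ≡ true × b ≡ false) ⊎ (a ≡ false × b ≡ true)
  exactlyOne {true}  b≡false = inj₁ (refl , b≡false)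
  exactlyOne {false} b≡true  = inj₂ (refl , b≡true)

-- minOutDeg folds from the seed n, hence the hypothesis outDeg T u ≤ n.
maxOutDeg∸minOutDeg≤ : ∀ {n} (T : Digraph n) s → (∀ u → outDeg T u ≤ n) →
  (∀ u w → outDeg T u ≤ outDeg T w + s) → maxOutDeg T ∸ minOutDeg T ≤ s
maxOutDeg∸minOutDeg≤ {n} T s ≤n close = m≤n+o⇒m∸n≤o (maxOutDeg T) (minOutDeg T)
  (foldr-preservesᵇ {P = _≤ minOutDeg T + s} ⊔-lub z≤n (forAllVertices λ u →
    foldr-preservesᵇ {P = λ d → outDeg T u ≤ d + s}
      (λ p q → subst (outDeg T u ≤_) (sym (+-distribʳ-⊓ s _ _)) (⊓-glb p q))
      (≤-trans (≤n u) (m≤m+n n s)) (forAllVertices (close u))))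
  where
  forAllVertices : ∀ {P : ℕ → Set} → (∀ u → P (outDeg T u)) → All P (map (outDeg T) (allFin n))
  forAllVertices Pu = All.map⁺ (All.tabulate⁺ Pu)

TwoPath : ∀ {n} → Digraph n → Fin n → Fin n → Set
TwoPath {n} D u v = Σ (Fin n) λ w → D u w ≡ true × D w v ≡ true

¬ContainsSubdivK-ofClasses : ∀ {n m k} (D : Digraph n) (class : Fin n → Fin m) → m < k →
  (∀ u v → u ≢ v → class u ≡ class v → TwoPath D u v → TwoPath D v u → ⊥) →
  ¬ ContainsSubdivK D k
¬ContainsSubdivK-ofClasses D class m<k noDoublePath (f , s , f-inj , _ , _ , arcs)
  with pigeonhole m<k (class ∘ f)
... | i , j , i<j , sameClass =
  noDoublePath (f i) (f j) (i≢j ∘ f-inj) sameClass (path i j i≢j) (path j i (≢-sym i≢j))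
  where
  i≢j : i ≢ j
  i≢j = <⇒≢ᶠ i<j
  path : ∀ a b (a≢b : a ≢ b) → TwoPath D (f a) (f b)
  path a b a≢b = s a b a≢b , arcs a b a≢b

module ClassTournament (m : ℕ) .{{_ : NonZero m}} where

  arc : ℕ → ℕ → Bool
  arc x y = if does (x % m ≟ y % m) then does (x <? y) else parityArc (x % m) (y % m)

  arc-sameClass : ∀ {x y} → x % m ≡ y % m → arc x y ≡ does (x <? y)
  arc-sameClass {x} {y} eq rewrite dec-true (x % m ≟ y % m) eq = refl

  arc-otherClass : ∀ {x y} → x % m ≢ y % m → arc x y ≡ parityArc (x % m) (y % m)
  arc-otherClass {x} {y} neq rewrite dec-false (x % m ≟ y % m) neq = refl

  arc-irrefl : ∀ x → arc x x ≡ false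
  arc-irrefl x = trans (arc-sameClass refl) (dec-false (x <? x) (<-irrefl refl))

  arc-flip : ∀ {x y} → x ≢ y → arc y x ≡ not (arc x y)
  arc-flip {x} {y} x≢y with x % m ≟ y % m
  ... | yes eq = trans (arc-sameClass (sym eq)) (trans (does-<?-flip x≢y) (cong not (sym (arc-sameClass eq))))
  ... | no neq = trans (arc-otherClass (≢-sym neq)) (trans (parityArc-flip neq) (cong not (sym (arc-otherClass neq))))

  sameClass-arc⇒< : ∀ {x y} → x % m ≡ y % m → arc x y ≡ true → x < y
  sameClass-arc⇒< {x} {y} eq xy with x <? y
  ... | yes x<y = x<y
  ... | no x≮y  = contradiction (trans (sym xy) (trans (arc-sameClass eq) (dec-false (x <? y) x≮y))) λ ()

  no-backward-2-path : ∀ {x z w} → x % m ≡ z % m → x < z → arc z w ≡ true → arc w x ≡ true → ⊥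
  no-backward-2-path {x} {z} {w} xz x<z zw wx with z % m ≟ w % m
  ... | yes eq = <-asym x<z (<-trans (sameClass-arc⇒< eq zw) (sameClass-arc⇒< (trans (sym eq) (sym xz)) wx))
  ... | no neq = contradiction (begin
    true                                ≡⟨ dc ⟨
    parityArc (w % m) (z % m)           ≡⟨ parityArc-flip neq ⟩
    not (parityArc (z % m) (w % m))     ≡⟨ cong not cd ⟩
    false                               ∎) λ ()
    where
    open ≡-Reasoning
    cd : parityArc (z % m) (w % m) ≡ true
    cd = trans (sym (arc-otherClass neq)) zw
    dc : parityArc (w % m) (z % m) ≡ true
    dc = subst (λ c → parityArc (w % m) c ≡ true) xz
               (trans (sym (arc-otherClass (neq ∘ trans (sym xz) ∘ sym))) wx)

  outDegreeBelow : ℕ → ℕ → ℕ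
  outDegreeBelow n x = sumBelow n (indicator ∘ arc x)

  arc≤parityArc : ∀ x y → indicator (arc x y) ≤ indicator (parityArc (x % m) (y % m))
  arc≤parityArc x y with x % m ≟ y % m
  ... | yes eq = ≤-trans (indicator≤1 (arc x y))
                   (≤-reflexive (cong indicator (sym (trans (cong (parityArc (x % m)) (sym eq)) (parityArc-refl (x % m))))))
  ... | no neq = ≤-reflexive (cong indicator (arc-otherClass neq))

  parityArc≤arc : ∀ x y →
    indicator (parityArc (x % m) (y % m)) ≤ indicator (arc x y) + indicator (does (x % m ≟ y % m))
  parityArc≤arc x y with x % m ≟ y % m
  ... | yes eq = ≤-trans (indicator≤1 _) (≤-trans (m≤n+m 1 _) (≤-reflexive (cong (λ b → indicator (arc x y) + indicator b)
                   (sym (dec-true (x % m ≟ y % m) eq)))))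
  ... | no neq = ≤-reflexive (trans (trans (cong indicator (sym (arc-otherClass neq))) (sym (+-identityʳ _)))
                   (cong (λ b → indicator (arc x y) + indicator b) (sym (dec-false (x % m ≟ y % m) neq))))

  outDegreeBelow-upper : ∀ n x →
    outDegreeBelow n x ≤ (n / m) * outPrefix (x % m) m + outPrefix (x % m) (n % m)
  outDegreeBelow-upper n x = ≤-trans (sumBelow-mono-≤ n (arc≤parityArc x))
                                     (≤-reflexive (sumBelow-periodic m n (indicator ∘ parityArc (x % m))))

  outDegreeBelow-lower : ∀ n x →
    (n / m) * outPrefix (x % m) m + outPrefix (x % m) (n % m) ≤ outDegreeBelow n x + (n / m + 1)
  outDegreeBelow-lower n x = begin
    q * outPrefix c m + outPrefix c r
      ≡⟨ sumBelow-periodic m n (indicator ∘ parityArc c) ⟨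
    sumBelow n (λ y → indicator (parityArc c (y % m)))
      ≤⟨ sumBelow-mono-≤ n (parityArc≤arc x) ⟩
    sumBelow n (λ y → indicator (arc x y) + sameClass (y % m))
      ≡⟨ sumBelow-+ n (indicator ∘ arc x) (sameClass ∘ (_% m)) ⟩
    outDegreeBelow n x + sumBelow n (sameClass ∘ (_% m))
      ≡⟨ cong (outDegreeBelow n x +_) (sumBelow-periodic m n sameClass) ⟩
    outDegreeBelow n x + (q * sumBelow m sameClass + sumBelow r sameClass)
      ≤⟨ +-monoʳ-≤ (outDegreeBelow n x) (+-mono-≤ (*-monoʳ-≤ q (sumBelow-indicator-≟ c m)) (sumBelow-indicator-≟ c r)) ⟩
    outDegreeBelow n x + (q * 1 + 1)
      ≡⟨ cong (λ z → outDegreeBelow n x + (z + 1)) (*-identityʳ q) ⟩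
    outDegreeBelow n x + (q + 1) ∎
    where
    open ≤-Reasoning
    c = x % m
    q = n / m
    r = n % m
    sameClass : ℕ → ℕ
    sameClass d = indicator (does (c ≟ d))

  outDegreeBelow-close : ∀ n x x' → outDegreeBelow n x ≤ outDegreeBelow n x' + 3 * (n / m + 1)
  outDegreeBelow-close n x x' = begin
    outDegreeBelow n x
      ≤⟨ outDegreeBelow-upper n x ⟩
    q * outPrefix c m + outPrefix c r
      ≤⟨ +-mono-≤ (*-monoʳ-≤ q (outPrefix-close c c' m)) (outPrefix-close c c' r) ⟩
    q * (2 + outPrefix c' m) + (2 + outPrefix c' r)
      ≡⟨ regroup q (outPrefix c' m) (outPrefix c' r) ⟩
    (q * outPrefix c' m + outPrefix c' r) + 2 * (q + 1)
      ≤⟨ +-monoˡ-≤ (2 * (q + 1)) (outDegreeBelow-lower n x') ⟩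
    outDegreeBelow n x' + (q + 1) + 2 * (q + 1)
      ≡⟨ +-assoc (outDegreeBelow n x') (q + 1) _ ⟩
    outDegreeBelow n x' + 3 * (q + 1) ∎
    where
    open ≤-Reasoning
    c = x % m
    c' = x' % m
    q = n / m
    r = n % m
    regroup : ∀ q a b → q * (2 + a) + (2 + b) ≡ (q * a + b) + 2 * (q + 1)
    regroup = solve-∀

  outDegreeBelow≤n : ∀ n x → outDegreeBelow n x ≤ n
  outDegreeBelow≤n n x = ≤-trans (sumBelow-mono-≤ n (indicator≤1 ∘ arc x))
                                 (≤-reflexive (trans (sumBelow-const n 1) (*-identityʳ n)))

  mod⇒% : ∀ {x y} → x mod m ≡ y mod m → x % m ≡ y % m
  mod⇒% eq = trans (sym (toℕ-fromℕ< _)) (trans (cong toℕ eq) (toℕ-fromℕ< _))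

  classTournament : ∀ n → Digraph n
  classTournament n u v = arc (toℕ u) (toℕ v)

  classTournament-isTournament : ∀ n → IsTournament (classTournament n)
  classTournament-isTournament n = isTournament-fromFlip (arc-irrefl ∘ toℕ)
    λ u v u≢v → arc-flip (u≢v ∘ toℕ-injective)

  outDeg-classTournament : ∀ n u → outDeg (classTournament n) u ≡ outDegreeBelow n (toℕ u)
  outDeg-classTournament n u = sum-map-allFin n (indicator ∘ arc (toℕ u))

  classTournament-spread : ∀ n →
    maxOutDeg (classTournament n) ∸ minOutDeg (classTournament n) ≤ 3 * (n / m + 1)
  classTournament-spread n = maxOutDeg∸minOutDeg≤ (classTournament n) _
    (λ u → subst (_≤ n) (sym (outDeg-classTournament n u)) (outDegreeBelow≤n n (toℕ u)))
    (λ u w → subst₂ (λ a b → a ≤ b + 3 * (n / m + 1))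
               (sym (outDeg-classTournament n u)) (sym (outDeg-classTournament n w))
               (outDegreeBelow-close n (toℕ u) (toℕ w)))

  classTournament-¬ContainsSubdivK : ∀ n → ¬ ContainsSubdivK (classTournament n) (suc m)
  classTournament-¬ContainsSubdivK n =
    ¬ContainsSubdivK-ofClasses (classTournament n) (λ u → toℕ u mod m) ≤-refl noDoublePath
    where
    noDoublePath : ∀ u v → u ≢ v → toℕ u mod m ≡ toℕ v mod m →
      TwoPath (classTournament n) u v → TwoPath (classTournament n) v u → ⊥
    noDoublePath u v u≢v sameClass (w , uw , wv) (w' , vw' , w'u) with <-cmp (toℕ u) (toℕ v)
    ... | tri< u<v _ _ = no-backward-2-path (mod⇒% sameClass) u<v vw' w'u
    ... | tri≈ _ u≡v _ = u≢v (toℕ-injective u≡v)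
    ... | tri> _ _ v<u = no-backward-2-path (sym (mod⇒% sameClass)) v<u uw wv

[1+m]*3[n/m+1]≤9n : ∀ n m .{{_ : NonZero m}} → suc m ≤ n → suc m * (3 * (n / m + 1)) ≤ 9 * n
[1+m]*3[n/m+1]≤9n n m 1+m≤n = begin
  suc m * (3 * (q + 1))                   ≡⟨ expand m q ⟩
  3 * (q * m) + 3 * q + 3 * suc m         ≤⟨ +-mono-≤ (+-mono-≤ (*-monoʳ-≤ 3 qm≤n)
                                                              (*-monoʳ-≤ 3 (≤-trans (m≤m*n q m) qm≤n)))
                                                    (*-monoʳ-≤ 3 1+m≤n) ⟩
  3 * n + 3 * n + 3 * n                   ≡⟨ triple n ⟩
  9 * n                                   ∎
  where
  open ≤-Reasoning
  q = n / m
  qm≤n : q * m ≤ n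
  qm≤n = m/n*n≤m n m
  expand : ∀ m q → suc m * (3 * (q + 1)) ≡ 3 * (q * m) + 3 * q + 3 * suc m
  expand = solve-∀
  triple : ∀ n → 3 * n + 3 * n + 3 * n ≡ 9 * n
  triple = solve-∀

open ClassTournament using (classTournament; classTournament-isTournament;
  classTournament-spread; classTournament-¬ContainsSubdivK)

proposition1p3 : Σ ℕ λ C → (1 ≤ C) × ((n k : ℕ) → 2 ≤ k → k ≤ n →
    Σ (Digraph n) λ T → IsTournament T ×
      (k * (maxOutDeg T ∸ minOutDeg T) ≤ C * n) ×
      ¬ ContainsSubdivK T k)
proposition1p3 = 9 , s≤s z≤n , λ where
  n (suc m@(suc _)) (s≤s (s≤s z≤n)) k≤n →
    classTournament m n ,
    classTournament-isTournament m n ,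
    ≤-trans (*-monoʳ-≤ (suc m) (classTournament-spread m n)) ([1+m]*3[n/m+1]≤9n n m k≤n) ,
    classTournament-¬ContainsSubdivK m n
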